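{- For every prime power $q$ and every positive integer $m$ there is a constant $C=C(q,m)$, independent of $n$, such that for all positive integers $n$ $$\left|E_n^{(m)}-\frac{mn}{m+1}\right|\le C,$$ i.e. $E_n^{(m)}=\frac{mn}{m+1}+O(1)$ where the implied constant depends only on $q$ and $m$.
   Context: Let $\mathbb{F}_q$ be the finite field with $q$ elements. An $m$-multisequence of length $n$ is an $m$-tuple $T=(S_1,\dots,S_m)$ of sequences $S_i=(s_{i,1},\dots,s_{i,n})\in\mathbb{F}_q^n$; the set of all of them is identified with $(\mathbb{F}_q^m)^n$ and has $q^{mn}$ elements. The joint linear complexity $L_n^{(m)}(T)$ is the least integer $L\ge 0$ such that there exist $c_1,\dots,c_L\in\mathbb{F}_q$ with $s_{i,j}=c_1s_{i,j-1}+\dots+c_Ls_{i,j-L}$ for all $1\le i\le m$ and all $L<j\le n$ (i.e. the length of the shortest linear feedback shift register simultaneously generating all $m$ sequences). The expected joint linear complexity is $E_n^{(m)}=q^{ -nm}\sum_{T\in(\mathbb{F}_q^m)^n}L_n^{(m)}(T)$. -}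

module Defs where

open import Level using (0ℓ)
open import Data.Nat using (NonZero; ℕ; zero; suc; _≤_; _<_; _∸_; _^_)
import Data.Nat as ℕ
open import Data.Fin using (Fin; zero; suc; toℕ)
open import Data.Vec using (Vec; []; _∷_; lookup)
open import Data.List using (List; []; _∷_; length; map; concatMap)
open import Data.Nat.ListAction using (sum)
open import Data.List.Membership.Propositional using (_∈_)
open import Data.List.Relation.Unary.Unique.Propositional using (Unique)
open import Data.Product using (Σ; ∃; _×_)
open import Relation.Nullary using (¬_)
open import Relation.Binary.PropositionalEquality using (_≡_)
open import Algebra.Structures using (IsCommutativeRing)
open import Data.Rational as ℚ using (ℚ)
open import Data.Integer as ℤ using (ℤ)
open import Data.Nat.Properties using (m^n≢0)

record FiniteField : Set₁ where
  field
    Carrier : Set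
    _+_ _*_ : Carrier → Carrier → Carrier
    -_      : Carrier → Carrier
    0# 1#   : Carrier
    isCommutativeRing : IsCommutativeRing _≡_ _+_ _*_ -_ 0# 1#
    0≢1     : ¬ (0# ≡ 1#)
    inverse : ∀ x → ¬ (x ≡ 0#) → Σ Carrier λ y → x * y ≡ 1#
    elems    : List Carrier
    complete : ∀ x → x ∈ elems
    unique   : Unique elems

  size : ℕ
  size = length elems

  size-nonZero : NonZero size
  size-nonZero = nz elems (complete 0#)
    where
    nz : (xs : List Carrier) → 0# ∈ xs → NonZero (length xs)
    nz (_ ∷ _) _ = _

module _ (F : FiniteField) where
  open FiniteField F

  -- s at (0-based) position j; returns 0 outside the range (never used there)
  at : ∀ {n} → Vec Carrier n → ℕ → Carrier
  at []       _       = 0#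
  at (x ∷ _)  zero    = x
  at (_ ∷ xs) (suc j) = at xs j

  sumF : ∀ {k} → (Fin k → Carrier) → Carrier
  sumF {zero}  f = 0#
  sumF {suc k} f = f zero + sumF (λ i → f (suc i))

  MultiSeq : ℕ → ℕ → Set
  MultiSeq m n = Vec (Vec Carrier n) m

  -- The LFSR with coefficients c_1..c_L (c = (c_1,…,c_L)) generates every S_i:
  -- for 0-based index j with L ≤ j < n (i.e. 1-based L < j+1 ≤ n),
  -- s_{i,j} = c_1 s_{i,j-1} + … + c_L s_{i,j-L}.
  Generates : ∀ {m n L} → MultiSeq m n → Vec Carrier L → Set
  Generates {m} {n} {L} T c =
    ∀ (i : Fin m) (j : ℕ) → L ≤ j → j < n →
      at (lookup T i) j ≡ sumF (λ k → lookup c k * at (lookup T i) (j ∸ suc (toℕ k)))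

  IsJointLinearComplexity : ∀ {m n} → MultiSeq m n → ℕ → Set
  IsJointLinearComplexity T L =
    (Σ (Vec Carrier L) λ c → Generates T c) ×
    (∀ L' → (Σ (Vec Carrier L') λ c → Generates T c) → L ≤ L')

  allVecs : ∀ {A : Set} → List A → (k : ℕ) → List (Vec A k)
  allVecs xs zero    = [] ∷ []
  allVecs xs (suc k) = concatMap (λ x → map (x ∷_) (allVecs xs k)) xs

  allMultiSeqs : (m n : ℕ) → List (MultiSeq m n)
  allMultiSeqs m n = allVecs (allVecs elems n) m

  expectedJLC : (JLC : ∀ m n → MultiSeq m n → ℕ) → (m n : ℕ) → ℚ
  expectedJLC JLC m n =
    ℚ._/_ (ℤ.+ (sum (map (JLC m n) (allMultiSeqs m n)))) (size ^ (m ℕ.* n))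
      {{m^n≢0 size (m ℕ.* n) {{size-nonZero}}}}

module Submission where

-- Let N = q^(mn), K = m + 1, and let c(L) count the multisequences of joint
-- linear complexity above L, so that the sum of all complexities is
-- Σ_{L<n} c(L).  A multisequence of complexity at most L is determined by a
-- register of length L and its first L columns, so N - c(L) ≤ q^(KL).  If the
-- complexity exceeds L, the m(n - L) × L linear system for the register is
-- unsolvable, and Gaussian elimination yields a nonzero left-kernel vector; this
-- vector, the other m - 1 sequences, and the pivot sequence with a window of L
-- terms removed determine the multisequence, so c(L) q^(KL) ≤ N².  Thus
-- c(L) ≈ N up to L ≈ mn/K and c(L) decays geometrically beyond, which gives
-- Σ_{L<n} c(L) = N mn/K + O(N).

open import Data.Nat using (ℕ; _≤_)
open import Defs

module Counting where

  open import Level using (Level)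
  open import Data.Nat using (ℕ; zero; suc; _+_; _*_; _≤_; z≤n; s≤s)
  import Data.Nat.Properties as ℕ
  open import Data.Fin as Fin using (Fin)
  open import Data.List using (List; []; _∷_; _++_; length; map; concatMap; filter; cartesianProductWith)
  open import Data.List.Properties using (length-++; length-map; length-removeAt′)
  open import Data.List.Relation.Unary.Any using (here; there; _─_)
  open import Data.List.Relation.Unary.All as All using ()
  open import Data.List.Relation.Unary.Unique.Propositional using (Unique; _∷_)
  open import Data.List.Membership.Propositional using (_∈_)
  open import Data.Product using (Σ-syntax; _×_; _,_)
  open import Data.Sum using (_⊎_; inj₁; inj₂)
  open import Data.Bool using (true; false)
  open import Function using (_∘_)
  open import Relation.Nullary using (¬_; yes; no; does; contradiction)
  open import Relation.Nullary.Decidable using (¬?)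
  open import Relation.Unary using (Pred; Decidable)
  open import Relation.Binary.PropositionalEquality

  private variable
    a : Level
    A B C : Set a

  ∈-─⁺ : ∀ {b z : A} {ys} (b∈ys : b ∈ ys) → z ∈ ys → z ≢ b → z ∈ (ys ─ b∈ys)
  ∈-─⁺ (here refl) (here refl) z≢b = contradiction refl z≢b
  ∈-─⁺ (here refl) (there z∈ys) _  = z∈ys
  ∈-─⁺ (there _)   (here z≡y)   _  = here z≡y
  ∈-─⁺ (there b∈ys) (there z∈ys) z≢b = there (∈-─⁺ b∈ys z∈ys z≢b)

  count : {P : Pred A a} → Decidable P → List A → ℕ
  count P? xs = length (filter P? xs)

  module _ {P : Pred A a} (P? : Decidable P) where

    count-∷ : ∀ x xs → count P? (x ∷ xs) ≡ count P? (x ∷ []) + count P? xs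
    count-∷ x xs with does (P? x)
    ... | true  = refl
    ... | false = refl

    count-[_]-yes : ∀ x → P x → count P? (x ∷ []) ≡ 1
    count-[ x ]-yes px with P? x
    ... | yes _   = refl
    ... | no  ¬px = contradiction px ¬px

    count-[_]-no : ∀ x → ¬ P x → count P? (x ∷ []) ≡ 0
    count-[ x ]-no ¬px with P? x
    ... | yes px = contradiction px ¬px
    ... | no  _  = refl

    count+count-¬≡length : ∀ xs → count P? xs + count (¬? ∘ P?) xs ≡ length xs
    count+count-¬≡length []       = refl
    count+count-¬≡length (x ∷ xs) with P? x
    ... | yes _ = cong suc (count+count-¬≡length xs)
    ... | no  _ = trans (ℕ.+-suc _ _) (cong suc (count+count-¬≡length xs))

    count≤length-of-injection : ∀ {xs} → Unique xs → (g : ∀ x → P x → B) {ys : List B} →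
      (∀ {x} → x ∈ xs → (p : P x) → g x p ∈ ys) → (∀ {x y} p q → g x p ≡ g y q → x ≡ y) →
      count P? xs ≤ length ys
    count≤length-of-injection {xs = []}     _          g into inj = z≤n
    count≤length-of-injection {xs = x ∷ xs} (x∉ ∷ uxs) g {ys} into inj with P? x
    ... | no  _  = count≤length-of-injection uxs g (into ∘ there) inj
    ... | yes px = subst (suc (count P? xs) ≤_) (sym (length-removeAt′ ys _))
        (s≤s (count≤length-of-injection uxs g into′ inj))
      where
      gx∈ys = into (here refl) px
      into′ : ∀ {y} → y ∈ xs → (q : P y) → g y q ∈ (ys ─ gx∈ys)
      into′ y∈xs q = ∈-─⁺ gx∈ys (into (there y∈xs) q) (λ gy≡gx → All.lookup x∉ y∈xs (sym (inj q px gy≡gx)))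

  length-cartesianProductWith : ∀ (f : A → B → C) xs ys →
    length (cartesianProductWith f xs ys) ≡ length xs * length ys
  length-cartesianProductWith f []       ys = refl
  length-cartesianProductWith f (x ∷ xs) ys = trans (length-++ (map (f x) ys))
    (cong₂ _+_ (length-map (f x) ys) (length-cartesianProductWith f xs ys))

  concatMap-map≡cartesianProductWith : ∀ (f : A → B → C) xs ys →
    concatMap (λ x → map (f x) ys) xs ≡ cartesianProductWith f xs ys
  concatMap-map≡cartesianProductWith f []       ys = refl
  concatMap-map≡cartesianProductWith f (x ∷ xs) ys = cong (map (f x) ys ++_) (concatMap-map≡cartesianProductWith f xs ys)

  last⊎none : ∀ {n} {P : Pred (Fin n) a} → Decidable P →
    (Σ[ r ∈ Fin n ] P r × (∀ r′ → r Fin.< r′ → ¬ P r′)) ⊎ (∀ r → ¬ P r)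
  last⊎none {n = zero}  P? = inj₂ (λ ())
  last⊎none {n = suc n} P? with last⊎none (P? ∘ Fin.suc)
  ... | inj₁ (r , Pr , after) = inj₁ (Fin.suc r , Pr , λ { Fin.zero () ; (Fin.suc r′) (s≤s r<r′) → after r′ r<r′ })
  ... | inj₂ none with P? Fin.zero
  ...   | yes P0 = inj₁ (Fin.zero , P0 , λ { Fin.zero () ; (Fin.suc r′) _ → none r′ })
  ...   | no ¬P0 = inj₂ (λ { Fin.zero → ¬P0 ; (Fin.suc r) → none r })

module NatSums where

  open import Level using (Level)
  open import Data.Nat using (ℕ; zero; suc; _+_; _*_; _^_; _⊓_; _≤_; _<_; _<?_; z≤n)
  import Data.Nat.Properties as ℕ
  open import Data.Nat.Solver using (module +-*-Solver)
  open import Data.Nat.ListAction using (sum)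
  open import Data.List using ([]; _∷_; map)
  open import Relation.Nullary using (yes; no)
  open import Relation.Binary.PropositionalEquality
  open Counting

  private variable
    a : Level
    A : Set a

  sumBelow : ℕ → (ℕ → ℕ) → ℕ
  sumBelow zero    h = 0
  sumBelow (suc n) h = sumBelow n h + h n

  module _ {h k : ℕ → ℕ} where

    sumBelow-cong : ∀ n → (∀ L → h L ≡ k L) → sumBelow n h ≡ sumBelow n k
    sumBelow-cong zero    h≡k = refl
    sumBelow-cong (suc n) h≡k = cong₂ _+_ (sumBelow-cong n h≡k) (h≡k n)

    sumBelow-mono-≤ : ∀ n → (∀ L → h L ≤ k L) → sumBelow n h ≤ sumBelow n k
    sumBelow-mono-≤ zero    h≤k = z≤n
    sumBelow-mono-≤ (suc n) h≤k = ℕ.+-mono-≤ (sumBelow-mono-≤ n h≤k) (h≤k n)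

    sumBelow-distrib-+ : ∀ n → sumBelow n (λ L → h L + k L) ≡ sumBelow n h + sumBelow n k
    sumBelow-distrib-+ zero    = refl
    sumBelow-distrib-+ (suc n) = trans (cong (_+ (h n + k n)) (sumBelow-distrib-+ n))
      (solve 4 (λ a b c d → a :+ b :+ (c :+ d) := a :+ c :+ (b :+ d)) refl (sumBelow n h) (sumBelow n k) (h n) (k n))
      where open +-*-Solver

  sumBelow-monoˡ-≤ : ∀ h {m n} → m ≤ n → sumBelow m h ≤ sumBelow n h
  sumBelow-monoˡ-≤ h {n = zero}  z≤n = z≤n
  sumBelow-monoˡ-≤ h {m} {suc n} m≤1+n with m ℕ.≤? n
  ... | yes m≤n = ℕ.≤-trans (sumBelow-monoˡ-≤ h m≤n) (ℕ.m≤m+n _ (h n))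
  ... | no  m≰n = ℕ.≤-reflexive (cong (λ z → sumBelow z h) (ℕ.≤-antisym m≤1+n (ℕ.≰⇒> m≰n)))

  sumBelow-+ : ∀ h a t → sumBelow (a + t) h ≡ sumBelow a h + sumBelow t (λ u → h (a + u))
  sumBelow-+ h a zero    = trans (cong (λ z → sumBelow z h) (ℕ.+-identityʳ a)) (sym (ℕ.+-identityʳ _))
  sumBelow-+ h a (suc t) = begin
    sumBelow (a + suc t) h                                    ≡⟨ cong (λ z → sumBelow z h) (ℕ.+-suc a t) ⟩
    sumBelow (a + t) h + h (a + t)                            ≡⟨ cong (_+ h (a + t)) (sumBelow-+ h a t) ⟩
    sumBelow a h + sumBelow t (λ u → h (a + u)) + h (a + t)   ≡⟨ ℕ.+-assoc (sumBelow a h) _ _ ⟩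
    sumBelow a h + sumBelow (suc t) (λ u → h (a + u))         ∎
    where open ≡-Reasoning

  sumBelow-const : ∀ n v → sumBelow n (λ _ → v) ≡ n * v
  sumBelow-const zero    v = refl
  sumBelow-const (suc n) v = trans (cong (_+ v) (sumBelow-const n v)) (ℕ.+-comm (n * v) v)

  sumBelow-geometric : ∀ {Q} → 2 ≤ Q → ∀ n → sumBelow n (Q ^_) ≤ Q ^ n
  sumBelow-geometric 2≤Q zero    = z≤n
  sumBelow-geometric {Q} 2≤Q (suc n) = begin
    sumBelow n (Q ^_) + Q ^ n  ≤⟨ ℕ.+-monoˡ-≤ (Q ^ n) (sumBelow-geometric 2≤Q n) ⟩
    Q ^ n + Q ^ n              ≡⟨ cong (Q ^ n +_) (ℕ.+-identityʳ (Q ^ n)) ⟨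
    2 * Q ^ n                  ≤⟨ ℕ.*-monoˡ-≤ (Q ^ n) 2≤Q ⟩
    Q ^ suc n                  ∎
    where open ℕ.≤-Reasoning

  sumBelow-halving : ∀ {N} (x : ℕ → ℕ) T → (∀ t → t < T → x t * 2 ^ t ≤ N) → sumBelow T x ≤ 2 * N
  sumBelow-halving {N} x T bound = ℕ.*-cancelˡ-≤ (2 ^ T) {{ℕ.m^n≢0 2 T}}
      (ℕ.≤-trans (ℕ.m≤m+n _ (2 * N)) (invariant T ℕ.≤-refl))
    where
    open +-*-Solver
    invariant : ∀ t → t ≤ T → 2 ^ t * sumBelow t x + 2 * N ≤ 2 ^ t * (2 * N)
    invariant zero    _ = ℕ.≤-reflexive (sym (ℕ.*-identityˡ (2 * N)))
    invariant (suc t) t<T = begin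
      2 * P * (Σ + x t) + 2 * N          ≡⟨ solve 4 (λ P Σ X N → con 2 :* P :* (Σ :+ X) :+ con 2 :* N
                                               := con 2 :* (P :* Σ) :+ con 2 :* (X :* P) :+ con 2 :* N) refl P Σ (x t) N ⟩
      2 * (P * Σ) + 2 * (x t * P) + 2 * N  ≤⟨ ℕ.+-monoˡ-≤ (2 * N) (ℕ.+-monoʳ-≤ (2 * (P * Σ)) (ℕ.*-monoʳ-≤ 2 (bound t t<T))) ⟩
      2 * (P * Σ) + 2 * N + 2 * N        ≡⟨ solve 2 (λ Y N → con 2 :* Y :+ con 2 :* N :+ con 2 :* N
                                               := con 2 :* (Y :+ con 2 :* N)) refl (P * Σ) N ⟩
      2 * (P * Σ + 2 * N)                ≤⟨ ℕ.*-monoʳ-≤ 2 (invariant t (ℕ.<⇒≤ t<T)) ⟩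
      2 * (P * (2 * N))                  ≡⟨ ℕ.*-assoc 2 P _ ⟨
      2 * P * (2 * N)                    ∎
      where
      open ℕ.≤-Reasoning
      P = 2 ^ t
      Σ = sumBelow t x

  sumBelow-indicator-< : ∀ (f : A → ℕ) x n → sumBelow n (λ L → count (λ y → L <? f y) (x ∷ [])) ≡ n ⊓ f x
  sumBelow-indicator-< f x zero = refl
  sumBelow-indicator-< f x (suc n) with n <? f x
  ... | yes n<fx = begin
    sumBelow n indicator + indicator n  ≡⟨ cong₂ _+_ (sumBelow-indicator-< f x n) (count-[_]-yes (λ y → n <? f y) x n<fx) ⟩
    n ⊓ f x + 1                         ≡⟨ cong (_+ 1) (ℕ.m≤n⇒m⊓n≡m (ℕ.<⇒≤ n<fx)) ⟩
    n + 1                               ≡⟨ ℕ.+-comm n 1 ⟩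
    suc n                               ≡⟨ ℕ.m≤n⇒m⊓n≡m n<fx ⟨
    suc n ⊓ f x                         ∎
    where
    open ≡-Reasoning
    indicator = λ L → count (λ y → L <? f y) (x ∷ [])
  ... | no  n≮fx = begin
    sumBelow n indicator + indicator n  ≡⟨ cong₂ _+_ (sumBelow-indicator-< f x n) (count-[_]-no (λ y → n <? f y) x n≮fx) ⟩
    n ⊓ f x + 0                         ≡⟨ ℕ.+-identityʳ (n ⊓ f x) ⟩
    n ⊓ f x                             ≡⟨ ℕ.m≥n⇒m⊓n≡n fx≤n ⟩
    f x                                 ≡⟨ ℕ.m≥n⇒m⊓n≡n (ℕ.m≤n⇒m≤1+n fx≤n) ⟨
    suc n ⊓ f x                         ∎
    where
    open ≡-Reasoning
    indicator = λ L → count (λ y → L <? f y) (x ∷ [])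
    fx≤n = ℕ.≮⇒≥ n≮fx

  sum≡sumBelow-count-< : ∀ (f : A → ℕ) n → (∀ x → f x ≤ n) → ∀ xs →
    sum (map f xs) ≡ sumBelow n (λ L → count (λ x → L <? f x) xs)
  sum≡sumBelow-count-< f n f≤n []       = sym (trans (sumBelow-const n 0) (ℕ.*-zeroʳ n))
  sum≡sumBelow-count-< f n f≤n (x ∷ xs) = begin
    f x + sum (map f xs)
      ≡⟨ cong₂ _+_ (trans (sym (ℕ.m≥n⇒m⊓n≡n (f≤n x))) (sym (sumBelow-indicator-< f x n)))
                   (sum≡sumBelow-count-< f n f≤n xs) ⟩
    sumBelow n (λ L → count (λ y → L <? f y) (x ∷ [])) + sumBelow n (λ L → count (λ y → L <? f y) xs)
      ≡⟨ sumBelow-distrib-+ n ⟨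
    sumBelow n (λ L → count (λ y → L <? f y) (x ∷ []) + count (λ y → L <? f y) xs)
      ≡⟨ sumBelow-cong n (λ L → count-∷ (λ y → L <? f y) x xs) ⟨
    sumBelow n (λ L → count (λ y → L <? f y) (x ∷ xs)) ∎
    where open ≡-Reasoning


module FiniteFieldProperties (F : FiniteField) where

  open import Level using (0ℓ)
  open import Data.Nat using (zero; suc; _≤_; z≤n; s≤s)
  open import Data.Fin as Fin using (Fin; punchIn)
  open import Data.Fin.Properties using (punchInᵢ≢i)
  open import Data.List using ([]; _∷_; length; lookup)
  open import Data.List.Relation.Unary.Any as Any using (here)
  open import Data.List.Relation.Unary.Any.Properties using (lookup-index)
  open import Data.List.Membership.Propositional using (_∈_)
  open import Data.Product as Product using (Σ-syntax; _×_; _,_)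
  open import Data.Sum as Sum using (_⊎_)
  open import Data.Vec.Functional using (removeAt)
  open import Function using (_∘_)
  open import Relation.Nullary using (¬_; contradiction)
  open import Relation.Nullary.Decidable using (¬?; map′; decidable-stable)
  open import Relation.Binary using (Decidable)
  open import Relation.Binary.PropositionalEquality
  open import Algebra.Bundles using (CommutativeRing)
  open import Algebra.Properties.Ring using (-‿distribˡ-*)
  import Algebra.Properties.Group as GroupProperties
  import Algebra.Properties.Semiring.Sum as SemiringSum
  import Algebra.Solver.Ring.NaturalCoefficients.Default as NaturalCoefficients
  open Counting using (last⊎none)

  open FiniteField F public using (Carrier; elems; complete; size; 0≢1; inverse)

  commutativeRing : CommutativeRing 0ℓ 0ℓ
  commutativeRing = record { isCommutativeRing = FiniteField.isCommutativeRing F }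

  open CommutativeRing commutativeRing public
    using ( _+_; _*_; -_; 0#; 1#; ring; semiring; commutativeSemiring
          ; +-group; +-comm; +-assoc; +-identityˡ; +-identityʳ; -‿inverseˡ
          ; *-comm; *-assoc; *-identityˡ; *-identityʳ; zeroˡ; zeroʳ )
  open SemiringSum semiring public
    using (sum; sum-syntax; ∑-permute; sum-cong-≗; sum-replicate-zero; sum-remove; ∑-distrib-+; *-distribˡ-sum; *-distribʳ-sum)

  infix 4 _≟_
  _≟_ : Decidable {A = Carrier} _≡_
  x ≟ y = map′ index-injective (cong position) (position x Fin.≟ position y)
    where
    position : Carrier → Fin (length elems)
    position z = Any.index (complete z)
    index-injective : ∀ {x y} → position x ≡ position y → x ≡ y
    index-injective {x} {y} eq = trans (lookup-index (complete x))
      (trans (cong (lookup elems) eq) (sym (lookup-index (complete y))))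

  2≤size : 2 ≤ size
  2≤size = two-elements elems (complete 0#) (complete 1#) 0≢1
    where
    two-elements : ∀ xs {x y} → x ∈ xs → y ∈ xs → x ≢ y → 2 ≤ length xs
    two-elements (_ ∷ []) (here refl) (here refl) x≢y = contradiction refl x≢y
    two-elements (_ ∷ _ ∷ _) _ _ _ = s≤s (s≤s z≤n)

  module Solver = NaturalCoefficients commutativeSemiring

  -x*y+x*y≡0 : ∀ x y → - x * y + x * y ≡ 0#
  -x*y+x*y≡0 x y = trans (cong (_+ x * y) (sym (-‿distribˡ-* ring x y))) (-‿inverseˡ (x * y))

  *-cancelˡ-≢0 : ∀ a {x y} → a ≢ 0# → a * x ≡ a * y → x ≡ y
  *-cancelˡ-≢0 a {x} {y} a≢0 eq with inverse a a≢0
  ... | b , ab≡1 = begin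
    x              ≡⟨ sym (*-identityˡ x) ⟩
    1# * x         ≡⟨ cong (_* x) (trans (sym ab≡1) (*-comm a b)) ⟩
    b * a * x      ≡⟨ *-assoc b a x ⟩
    b * (a * x)    ≡⟨ cong (b *_) eq ⟩
    b * (a * y)    ≡⟨ sym (*-assoc b a y) ⟩
    b * a * y      ≡⟨ cong (_* y) (trans (*-comm b a) ab≡1) ⟩
    1# * y         ≡⟨ *-identityˡ y ⟩
    y              ∎
    where open ≡-Reasoning

  sumF≡sum : ∀ {k} (f : Fin k → Carrier) → sumF F f ≡ sum f
  sumF≡sum {zero}  f = refl
  sumF≡sum {suc k} f = cong (f Fin.zero +_) (sumF≡sum (f ∘ Fin.suc))

  sumF-cong : ∀ {k} {f g : Fin k → Carrier} → (∀ i → f i ≡ g i) → sumF F f ≡ sumF F g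
  sumF-cong {f = f} {g} f≗g = trans (sumF≡sum f) (trans (sum-cong-≗ f≗g) (sym (sumF≡sum g)))

  sum-zero : ∀ {k} (f : Fin k → Carrier) → (∀ i → f i ≡ 0#) → sum f ≡ 0#
  sum-zero {k} f f≗0 = trans (sum-cong-≗ f≗0) (sum-replicate-zero k)

  sum-agree-except : ∀ {n} (f g : Fin n → Carrier) r → (∀ r′ → r′ ≢ r → f r′ ≡ g r′) → sum f ≡ sum g → f r ≡ g r
  sum-agree-except {suc n} f g r f≗g ∑f≡∑g = +-cancelʳ (sum (removeAt f r)) (f r) (g r) (begin
    f r + sum (removeAt f r)  ≡⟨ sum-remove f ⟨
    sum f                     ≡⟨ ∑f≡∑g ⟩
    sum g                     ≡⟨ sum-remove g ⟩
    g r + sum (removeAt g r)  ≡⟨ cong (g r +_) (sum-cong-≗ (λ t → f≗g (punchIn r t) (punchInᵢ≢i r t))) ⟨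
    g r + sum (removeAt f r)  ∎)
    where
    open ≡-Reasoning
    open GroupProperties +-group using () renaming (∙-cancelʳ to +-cancelʳ)

  LastNonzero : ∀ {n} → (Fin n → Carrier) → Set
  LastNonzero {n} y = Σ[ r ∈ Fin n ] y r ≢ 0# × (∀ r′ → r Fin.< r′ → y r′ ≡ 0#)

  lastNonzero⊎zero : ∀ {n} (y : Fin n → Carrier) → LastNonzero y ⊎ (∀ r → y r ≡ 0#)
  lastNonzero⊎zero y = Sum.map (Product.map₂ (Product.map₂ (λ after r′ r<r′ → zero-stable (after r′ r<r′))))
                               (λ none r → zero-stable (none r))
                               (last⊎none (λ r → ¬? (y r ≟ 0#)))
    where
    zero-stable : ∀ {x} → ¬ x ≢ 0# → x ≡ 0#
    zero-stable {x} = decidable-stable (x ≟ 0#)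

module Enumeration (F : FiniteField) where

  open import Data.Nat using (zero; suc; _*_; _^_)
  open import Data.List using (List; length; cartesianProductWith)
  open import Data.List.Relation.Unary.Any using (here)
  open import Data.List.Relation.Unary.All as All using ()
  open import Data.List.Relation.Unary.Unique.Propositional using (Unique; []; _∷_)
  open import Data.List.Relation.Unary.Unique.Propositional.Properties using (cartesianProductWith⁺)
  open import Data.List.Membership.Propositional using (_∈_)
  open import Data.List.Membership.Propositional.Properties using (∈-cartesianProductWith⁺)
  open import Data.Vec using (Vec; []; _∷_)
  open import Data.Vec.Properties using (∷-injective)
  open import Relation.Binary.PropositionalEquality
  open Counting using (length-cartesianProductWith; concatMap-map≡cartesianProductWith)
  open FiniteField F using (elems; complete; unique; size)

  module _ {A : Set} (xs : List A) where

    allVecs-suc : ∀ k → allVecs F xs (suc k) ≡ cartesianProductWith _∷_ xs (allVecs F xs k)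
    allVecs-suc k = concatMap-map≡cartesianProductWith _∷_ xs (allVecs F xs k)

    ∈-allVecs : (∀ x → x ∈ xs) → ∀ {k} (v : Vec A k) → v ∈ allVecs F xs k
    ∈-allVecs _     []      = here refl
    ∈-allVecs all∈ (x ∷ v) = subst (x ∷ v ∈_) (sym (allVecs-suc _))
      (∈-cartesianProductWith⁺ _∷_ (all∈ x) (∈-allVecs all∈ v))

    length-allVecs : ∀ k → length (allVecs F xs k) ≡ length xs ^ k
    length-allVecs zero    = refl
    length-allVecs (suc k) = trans (cong length (allVecs-suc k))
      (trans (length-cartesianProductWith _∷_ xs _) (cong (length xs *_) (length-allVecs k)))

    allVecs-unique : Unique xs → ∀ k → Unique (allVecs F xs k)
    allVecs-unique _   zero    = All.[] ∷ []
    allVecs-unique uxs (suc k) = subst Unique (sym (allVecs-suc k))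
      (cartesianProductWith⁺ _∷_ ∷-injective uxs (allVecs-unique uxs k))

  allMultiSeqs-unique : ∀ m n → Unique (allMultiSeqs F m n)
  allMultiSeqs-unique m n = allVecs-unique (allVecs F elems n) (allVecs-unique elems unique n) m

  length-allMultiSeqs : ∀ m n → length (allMultiSeqs F m n) ≡ (size ^ n) ^ m
  length-allMultiSeqs m n = trans (length-allVecs (allVecs F elems n) m) (cong (_^ m) (length-allVecs elems n))

module LinearAlgebra (F : FiniteField) where

  open import Data.Nat using (ℕ; zero; suc)
  open import Data.Fin as Fin using (Fin; zero; suc; punchIn; punchOut)
  open import Data.Fin.Properties using (any?; punchIn-punchOut)
  import Data.Fin.Properties as Fin
  open import Data.Vec.Functional using (insertAt; _∷_)
  open import Data.Vec.Functional.Properties using (insertAt-lookup; insertAt-punchIn)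
  open import Data.Product using (Σ-syntax; ∃; _×_; _,_; proj₁; proj₂)
  open import Data.Sum as Sum using (_⊎_; inj₁; inj₂)
  open import Relation.Nullary using (¬_; yes; no)
  open import Relation.Nullary.Decidable using (¬?; decidable-stable)
  open import Relation.Binary.PropositionalEquality
  open FiniteFieldProperties F

  open Solver using (solve; _:=_; _:+_; _:*_)

  Matrix : ℕ → ℕ → Set
  Matrix R L = Fin R → Fin L → Carrier

  HasLeftKernel : ∀ {R L} → Matrix R L → Set
  HasLeftKernel {R} A = Σ[ y ∈ (Fin R → Carrier) ] (∃ λ r → y r ≢ 0#) × (∀ l → ∑[ r < R ] (y r * A r l) ≡ 0#)

  Solvable : ∀ {R L} → Matrix R L → Set
  Solvable {R} {L} A = (b : Fin R → Carrier) → Σ[ c ∈ (Fin L → Carrier) ] (∀ r → ∑[ l < L ] (A r l * c l) ≡ b r)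

  module ZeroColumn {R L} (A : Matrix R (suc L)) (column₀≡0 : ∀ r → A r zero ≡ 0#) where

    leftKernel : HasLeftKernel (λ r l → A r (suc l)) → HasLeftKernel A
    leftKernel (y , y≢0 , yA≡0) = y , y≢0 , λ
      { zero    → sum-zero _ (λ r → trans (cong (y r *_) (column₀≡0 r)) (zeroʳ (y r)))
      ; (suc l) → yA≡0 l }

    solvable : Solvable (λ r l → A r (suc l)) → Solvable A
    solvable solve-tail b = (0# ∷ c) , λ r →
        trans (cong (_+ ∑[ l < L ] (A r (suc l) * c l)) (zeroʳ (A r zero))) (trans (+-identityˡ _) (Ac≡b r))
      where
      c = proj₁ (solve-tail b)
      Ac≡b = proj₂ (solve-tail b)

  module Pivot {R L} (A : Matrix (suc R) (suc L)) (r₀ : Fin (suc R)) (a≢0 : A r₀ zero ≢ 0#) where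

    a a⁻¹ : Carrier
    a   = A r₀ zero
    a⁻¹ = proj₁ (inverse a a≢0)

    μ : Fin R → Carrier
    μ t = A (punchIn r₀ t) zero * a⁻¹

    eliminated : Matrix R (suc L)
    eliminated t l = A (punchIn r₀ t) l + - μ t * A r₀ l

    μ-pivot : ∀ t → μ t * a ≡ A (punchIn r₀ t) zero
    μ-pivot t = begin
      A (punchIn r₀ t) zero * a⁻¹ * a    ≡⟨ *-assoc _ a⁻¹ a ⟩
      A (punchIn r₀ t) zero * (a⁻¹ * a)  ≡⟨ cong (A (punchIn r₀ t) zero *_) (trans (*-comm a⁻¹ a) a*a⁻¹≡1) ⟩
      A (punchIn r₀ t) zero * 1#         ≡⟨ *-identityʳ _ ⟩
      A (punchIn r₀ t) zero              ∎
      where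
      open ≡-Reasoning
      a*a⁻¹≡1 = proj₂ (inverse a a≢0)

    eliminated-column₀ : ∀ t → eliminated t zero ≡ 0#
    eliminated-column₀ t = begin
      A (punchIn r₀ t) zero + - μ t * a  ≡⟨ cong (_+ - μ t * a) (μ-pivot t) ⟨
      μ t * a + - μ t * a                ≡⟨ +-comm (μ t * a) _ ⟩
      - μ t * a + μ t * a                ≡⟨ -x*y+x*y≡0 (μ t) a ⟩
      0#                                 ∎
      where open ≡-Reasoning

    reduced : Matrix R L
    reduced t l = eliminated t (suc l)

    leftKernel : HasLeftKernel reduced → HasLeftKernel A
    leftKernel (y′ , (t₀ , y′t₀≢0) , y′R≡0) = y , (punchIn r₀ t₀ , yt₀≢0) , yA≡0
      where
      y : Fin (suc R) → Carrier
      y = insertAt y′ r₀ (∑[ t < R ] (y′ t * - μ t))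

      yt₀≢0 : y (punchIn r₀ t₀) ≢ 0#
      yt₀≢0 yt₀≡0 = y′t₀≢0 (trans (sym (insertAt-punchIn y′ r₀ _ t₀)) yt₀≡0)

      yA≡y′E : ∀ l → ∑[ r < suc R ] (y r * A r l) ≡ ∑[ t < R ] (y′ t * eliminated t l)
      yA≡y′E l = begin
        ∑[ r < suc R ] (y r * A r l)
          ≡⟨ sum-remove {i = r₀} (λ r → y r * A r l) ⟩
        y r₀ * A r₀ l + ∑[ t < R ] (y (punchIn r₀ t) * A (punchIn r₀ t) l)
          ≡⟨ cong₂ _+_ (cong (_* A r₀ l) (insertAt-lookup y′ r₀ _))
                       (sum-cong-≗ (λ t → cong (_* A (punchIn r₀ t) l) (insertAt-punchIn y′ r₀ _ t))) ⟩
        ∑[ t < R ] (y′ t * - μ t) * A r₀ l + ∑[ t < R ] (y′ t * A (punchIn r₀ t) l)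
          ≡⟨ cong (_+ ∑[ t < R ] (y′ t * A (punchIn r₀ t) l)) (*-distribʳ-sum (A r₀ l) (λ t → y′ t * - μ t)) ⟩
        ∑[ t < R ] (y′ t * - μ t * A r₀ l) + ∑[ t < R ] (y′ t * A (punchIn r₀ t) l)
          ≡⟨ ∑-distrib-+ (λ t → y′ t * - μ t * A r₀ l) (λ t → y′ t * A (punchIn r₀ t) l) ⟨
        ∑[ t < R ] (y′ t * - μ t * A r₀ l + y′ t * A (punchIn r₀ t) l)
          ≡⟨ sum-cong-≗ (λ t → solve 4 (λ y m x z → y :* m :* x :+ y :* z := y :* (z :+ m :* x))
                                        refl (y′ t) (- μ t) (A r₀ l) (A (punchIn r₀ t) l)) ⟩
        ∑[ t < R ] (y′ t * eliminated t l) ∎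
        where open ≡-Reasoning

      yA≡0 : ∀ l → ∑[ r < suc R ] (y r * A r l) ≡ 0#
      yA≡0 zero    = trans (yA≡y′E zero)
        (sum-zero _ (λ t → trans (cong (y′ t *_) (eliminated-column₀ t)) (zeroʳ (y′ t))))
      yA≡0 (suc l) = trans (yA≡y′E (suc l)) (y′R≡0 l)

    split-row-entry : ∀ z m x c → (z + - m * x) * c + m * (x * c) ≡ z * c
    split-row-entry z m x c = begin
      (z + - m * x) * c + m * (x * c)        ≡⟨ solve 5 (λ z n m x c → (z :+ n :* x) :* c :+ m :* (x :* c)
                                                  := z :* c :+ (n :* (x :* c) :+ m :* (x :* c))) refl z (- m) m x c ⟩
      z * c + (- m * (x * c) + m * (x * c))  ≡⟨ cong (z * c +_) (-x*y+x*y≡0 m (x * c)) ⟩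
      z * c + 0#                             ≡⟨ +-identityʳ (z * c) ⟩
      z * c                                  ∎
      where open ≡-Reasoning

    row-decomposition : ∀ t (c : Fin (suc L) → Carrier) →
      ∑[ l < suc L ] (A (punchIn r₀ t) l * c l) ≡ ∑[ l < suc L ] (eliminated t l * c l) + μ t * ∑[ l < suc L ] (A r₀ l * c l)
    row-decomposition t c = begin
      ∑[ l < suc L ] (A (punchIn r₀ t) l * c l)
        ≡⟨ sum-cong-≗ (λ l → sym (split-row-entry (A (punchIn r₀ t) l) (μ t) (A r₀ l) (c l))) ⟩
      ∑[ l < suc L ] (eliminated t l * c l + μ t * (A r₀ l * c l))
        ≡⟨ ∑-distrib-+ (λ l → eliminated t l * c l) (λ l → μ t * (A r₀ l * c l)) ⟩
      ∑[ l < suc L ] (eliminated t l * c l) + ∑[ l < suc L ] (μ t * (A r₀ l * c l))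
        ≡⟨ cong (∑[ l < suc L ] (eliminated t l * c l) +_) (*-distribˡ-sum (μ t) (λ l → A r₀ l * c l)) ⟨
      ∑[ l < suc L ] (eliminated t l * c l) + μ t * ∑[ l < suc L ] (A r₀ l * c l) ∎
      where open ≡-Reasoning

    module BackSubstitution (solve-reduced : Solvable reduced) (b : Fin (suc R) → Carrier) where

      b′ : Fin R → Carrier
      b′ t = b (punchIn r₀ t) + - μ t * b r₀
      c′ = proj₁ (solve-reduced b′)
      X  = ∑[ l < L ] (A r₀ (suc l) * c′ l)
      c : Fin (suc L) → Carrier
      c = a⁻¹ * (b r₀ + - X) ∷ c′

      row₀ : ∑[ l < suc L ] (A r₀ l * c l) ≡ b r₀
      row₀ = begin
        a * (a⁻¹ * (b r₀ + - X)) + X  ≡⟨ cong (_+ X) (sym (*-assoc a a⁻¹ _)) ⟩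
        a * a⁻¹ * (b r₀ + - X) + X    ≡⟨ cong (λ z → z * (b r₀ + - X) + X) (proj₂ (inverse a a≢0)) ⟩
        1# * (b r₀ + - X) + X         ≡⟨ cong (_+ X) (*-identityˡ _) ⟩
        b r₀ + - X + X                ≡⟨ +-assoc (b r₀) (- X) X ⟩
        b r₀ + (- X + X)              ≡⟨ cong (b r₀ +_) (-‿inverseˡ X) ⟩
        b r₀ + 0#                     ≡⟨ +-identityʳ (b r₀) ⟩
        b r₀                          ∎
        where open ≡-Reasoning

      eliminated-row : ∀ t → ∑[ l < suc L ] (eliminated t l * c l) ≡ b′ t
      eliminated-row t = begin
        eliminated t zero * c zero + ∑[ l < L ] (reduced t l * c′ l)
          ≡⟨ cong₂ _+_ (trans (cong (_* c zero) (eliminated-column₀ t)) (zeroˡ (c zero))) (proj₂ (solve-reduced b′) t) ⟩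
        0# + b′ t
          ≡⟨ +-identityˡ (b′ t) ⟩
        b′ t ∎
        where open ≡-Reasoning

      row : ∀ t → ∑[ l < suc L ] (A (punchIn r₀ t) l * c l) ≡ b (punchIn r₀ t)
      row t = begin
        ∑[ l < suc L ] (A (punchIn r₀ t) l * c l)
          ≡⟨ row-decomposition t c ⟩
        ∑[ l < suc L ] (eliminated t l * c l) + μ t * ∑[ l < suc L ] (A r₀ l * c l)
          ≡⟨ cong₂ (λ u v → u + μ t * v) (eliminated-row t) row₀ ⟩
        b (punchIn r₀ t) + - μ t * b r₀ + μ t * b r₀
          ≡⟨ +-assoc (b (punchIn r₀ t)) _ _ ⟩
        b (punchIn r₀ t) + (- μ t * b r₀ + μ t * b r₀)
          ≡⟨ cong (b (punchIn r₀ t) +_) (-x*y+x*y≡0 (μ t) (b r₀)) ⟩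
        b (punchIn r₀ t) + 0#
          ≡⟨ +-identityʳ _ ⟩
        b (punchIn r₀ t) ∎
        where open ≡-Reasoning

      Ac≡b : ∀ r → ∑[ l < suc L ] (A r l * c l) ≡ b r
      Ac≡b r with r₀ Fin.≟ r
      ... | yes refl = row₀
      ... | no  r₀≢r = subst (λ r → ∑[ l < suc L ] (A r l * c l) ≡ b r) (punchIn-punchOut r₀≢r) (row (punchOut r₀≢r))

    solvable : Solvable reduced → Solvable A
    solvable solve-reduced b = c , Ac≡b
      where open BackSubstitution solve-reduced b

  leftKernel⊎solvable : ∀ {R L} (A : Matrix R L) → HasLeftKernel A ⊎ Solvable A
  leftKernel⊎solvable {zero}          A = inj₂ (λ b → (λ _ → 0#) , λ ())
  leftKernel⊎solvable {suc R} {zero}  A = inj₁ ((λ _ → 1#) , (zero , λ 1≡0 → 0≢1 (sym 1≡0)) , λ ())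
  leftKernel⊎solvable {suc R} {suc L} A with any? (λ r → ¬? (A r zero ≟ 0#))
  ... | yes (r₀ , a≢0) = Sum.map leftKernel solvable (leftKernel⊎solvable reduced)
    where open Pivot A r₀ a≢0
  ... | no  none       = Sum.map leftKernel solvable (leftKernel⊎solvable (λ r l → A r (suc l)))
    where open ZeroColumn A (λ r → decidable-stable (A r zero ≟ 0#) (λ a≢0 → none (r , a≢0)))

module LinearRecurrences (F : FiniteField) where

  open import Data.Nat as ℕ using (ℕ; zero; suc; _≤_; _<_; _∸_; _<?_; z≤n; s≤s)
  import Data.Nat.Properties as ℕ
  open import Data.Nat.Induction using (<-rec)
  open import Data.Fin as Fin using (Fin; zero; suc; toℕ)
  import Data.Fin.Properties as Fin
  open import Data.Vec as Vec using (Vec; []; _∷_; lookup; tabulate)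
  open import Data.Vec.Properties using (lookup∘tabulate; tabulate∘lookup; tabulate-cong; lookup-map)
  open import Function using (_∘_)
  open import Relation.Nullary using (yes; no; contradiction)
  open import Relation.Binary.PropositionalEquality
  open FiniteFieldProperties F


  at-≥ : ∀ {k} (v : Vec Carrier k) {j} → k ≤ j → at F v j ≡ 0#
  at-≥ []      _         = refl
  at-≥ (x ∷ v) (s≤s k≤j) = at-≥ v k≤j

  at-extensional : ∀ {k} (v w : Vec Carrier k) → (∀ j → at F v j ≡ at F w j) → v ≡ w
  at-extensional []      []      _   = refl
  at-extensional (x ∷ v) (y ∷ w) v≗w = cong₂ _∷_ (v≗w zero) (at-extensional v w (v≗w ∘ suc))

  at-tabulate : ∀ {k} (f : ℕ → Carrier) {j} → j < k → at F (tabulate {n = k} (f ∘ toℕ)) j ≡ f j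
  at-tabulate {suc k} f {zero}  _         = refl
  at-tabulate {suc k} f {suc j} (s≤s j<k) = at-tabulate (f ∘ suc) j<k

  -- The first L entries of v, padded with zeros (the value of `at` out of range).
  resize : ∀ {a} L → Vec Carrier a → Vec Carrier L
  resize L v = tabulate (λ k → at F v (toℕ k))

  vec-extensional : ∀ {A : Set} {k} (v w : Vec A k) → (∀ i → lookup v i ≡ lookup w i) → v ≡ w
  vec-extensional v w v≗w = trans (sym (tabulate∘lookup v)) (trans (tabulate-cong v≗w) (tabulate∘lookup w))

  module _ {m n : ℕ} where

    generates-≥ : ∀ {L} (T : MultiSeq F m n) (c : Vec Carrier L) → n ≤ L → Generates F T c
    generates-≥ T c n≤L i j L≤j j<n = contradiction (ℕ.≤-trans n≤L L≤j) (ℕ.<⇒≱ j<n)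

    sumF-resize : ∀ {a} L (c : Vec Carrier a) (g : ℕ → Carrier) → a ≤ L →
      sumF F {L} (λ k → at F c (toℕ k) * g (toℕ k)) ≡ sumF F (λ k → lookup c k * g (toℕ k))
    sumF-resize L       []      g _         =
      trans (sumF≡sum {L} _) (sum-zero {L} (λ k → 0# * g (toℕ k)) (λ k → zeroˡ (g (toℕ k))))
    sumF-resize (suc L) (x ∷ c) g (s≤s a≤L) = cong (x * g 0 +_) (sumF-resize L c (g ∘ suc) a≤L)

    generates-resize : ∀ {a L} (T : MultiSeq F m n) (c : Vec Carrier a) → a ≤ L →
      Generates F T c → Generates F T (resize L c)
    generates-resize {L = L} T c a≤L gen i j L≤j j<n = begin
      at F Tᵢ j
        ≡⟨ gen i j (ℕ.≤-trans a≤L L≤j) j<n ⟩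
      sumF F (λ k → lookup c k * at F Tᵢ (j ∸ suc (toℕ k)))
        ≡⟨ sumF-resize L c (λ k → at F Tᵢ (j ∸ suc k)) a≤L ⟨
      sumF F {L} (λ k → at F c (toℕ k) * at F Tᵢ (j ∸ suc (toℕ k)))
        ≡⟨ sumF-cong {L} (λ k → cong (_* at F Tᵢ (j ∸ suc (toℕ k))) (lookup∘tabulate (λ k → at F c (toℕ k)) k)) ⟨
      sumF F {L} (λ k → lookup (resize L c) k * at F Tᵢ (j ∸ suc (toℕ k))) ∎
      where
      open ≡-Reasoning
      Tᵢ = lookup T i

    generated-by-prefix : ∀ {L} (T T′ : MultiSeq F m n) (c : Vec Carrier L) →
      Generates F T c → Generates F T′ c → Vec.map (resize L) T ≡ Vec.map (resize L) T′ → T ≡ T′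
    generated-by-prefix {L} T T′ c gen gen′ same-prefix =
      vec-extensional T T′ (λ i → at-extensional _ _ (<-rec _ (entry i)))
      where
      entry : ∀ i j → (∀ {j′} → j′ < j → at F (lookup T i) j′ ≡ at F (lookup T′ i) j′) →
        at F (lookup T i) j ≡ at F (lookup T′ i) j
      entry i j earlier with j <? L | j <? n
      ... | yes j<L | _ = begin
        at F (lookup T i) j                           ≡⟨ at-tabulate (at F (lookup T i)) j<L ⟨
        at F (resize L (lookup T i)) j                ≡⟨ cong (λ v → at F v j) (lookup-map i (resize L) T) ⟨
        at F (lookup (Vec.map (resize L) T) i) j      ≡⟨ cong (λ P → at F (lookup P i) j) same-prefix ⟩
        at F (lookup (Vec.map (resize L) T′) i) j     ≡⟨ cong (λ v → at F v j) (lookup-map i (resize L) T′) ⟩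
        at F (resize L (lookup T′ i)) j               ≡⟨ at-tabulate (at F (lookup T′ i)) j<L ⟩
        at F (lookup T′ i) j                          ∎
        where open ≡-Reasoning
      ... | no _   | no j≮n = trans (at-≥ (lookup T i) (ℕ.≮⇒≥ j≮n)) (sym (at-≥ (lookup T′ i) (ℕ.≮⇒≥ j≮n)))
      ... | no j≮L | yes j<n = begin
        at F (lookup T i) j                                   ≡⟨ gen i j L≤j j<n ⟩
        sumF F (λ k → lookup c k * at F (lookup T i) (j ∸ suc (toℕ k)))   ≡⟨ sumF-cong (λ k → cong (lookup c k *_) (earlier (back k))) ⟩
        sumF F (λ k → lookup c k * at F (lookup T′ i) (j ∸ suc (toℕ k)))  ≡⟨ gen′ i j L≤j j<n ⟨
        at F (lookup T′ i) j                                  ∎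
        where
        open ≡-Reasoning
        L≤j = ℕ.≮⇒≥ j≮L
        back : ∀ (k : Fin L) → j ∸ suc (toℕ k) < j
        back k = ℕ.∸-monoʳ-< (s≤s z≤n) (ℕ.≤-trans (Fin.toℕ<n k) L≤j)

module Complexity (F : FiniteField) (JLC : ∀ k l → MultiSeq F k l → ℕ)
                  (isJLC : ∀ k l (T : MultiSeq F k l) → IsJointLinearComplexity F T (JLC k l T)) where

  open import Data.Nat as ℕ using (ℕ; _≤_; _<_; _^_; _<?_)
  import Data.Nat.Properties as ℕ
  open import Data.Vec as Vec using (Vec)
  open import Data.List using (cartesianProduct; length)
  open import Data.List.Membership.Propositional.Properties using (∈-cartesianProduct⁺)
  open import Data.Product using (_×_; _,_; proj₁; proj₂)
  open import Data.List.Membership.Propositional using (_∈_)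
  open import Data.Product.Properties using (,-injective)
  open import Relation.Nullary using (¬_)
  open import Relation.Nullary.Decidable using (¬?)
  open import Relation.Binary.PropositionalEquality hiding (J)
  open Counting
  open FiniteFieldProperties F
  open Enumeration F
  open LinearRecurrences F


  module _ {m n : ℕ} where

    J : MultiSeq F m n → ℕ
    J = JLC m n

    shortestRegister : (T : MultiSeq F m n) → Vec Carrier (J T)
    shortestRegister T = proj₁ (proj₁ (isJLC m n T))

    shortestRegister-generates : (T : MultiSeq F m n) → Generates F T (shortestRegister T)
    shortestRegister-generates T = proj₂ (proj₁ (isJLC m n T))

    J-minimal : ∀ {L} (T : MultiSeq F m n) (c : Vec Carrier L) → Generates F T c → J T ≤ L
    J-minimal {L} T c gen = proj₂ (isJLC m n T) L (c , gen)

    J≤n : ∀ T → J T ≤ n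
    J≤n T = J-minimal T (Vec.replicate n 0#) (generates-≥ T (Vec.replicate n 0#) ℕ.≤-refl)

  count-J≤ : ∀ m n L → count (λ T → ¬? (L <? J T)) (allMultiSeqs F m n) ≤ size ^ L ℕ.* (size ^ L) ^ m
  count-J≤ m n L = subst (count (λ T → ¬? (L <? J T)) (allMultiSeqs F m n) ≤_) length-targets
    (count≤length-of-injection (λ T → ¬? (L <? J T)) (allMultiSeqs-unique m n) encode
      (λ _ p → encode∈targets {p = p}) encode-injective)
    where
    targets = cartesianProduct (allVecs F elems L) (allVecs F (allVecs F elems L) m)

    length-targets : length targets ≡ size ^ L ℕ.* (size ^ L) ^ m
    length-targets = trans (length-cartesianProductWith _,_ (allVecs F elems L) (allVecs F (allVecs F elems L) m))
      (cong₂ ℕ._*_ (length-allVecs elems L) (trans (length-allVecs (allVecs F elems L) m) (cong (_^ m) (length-allVecs elems L))))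

    encode : (T : MultiSeq F m n) → ¬ L < J T → Vec Carrier L × Vec (Vec Carrier L) m
    encode T _ = resize L (shortestRegister T) , Vec.map (resize L) T

    encode∈targets : ∀ {T} {p : ¬ L < J T} → encode T p ∈ targets
    encode∈targets = ∈-cartesianProduct⁺ (∈-allVecs elems complete _) (∈-allVecs (allVecs F elems L) (∈-allVecs elems complete) _)

    encode-injective : ∀ {T T′} p p′ → encode T p ≡ encode T′ p′ → T ≡ T′
    encode-injective {T} {T′} p p′ same = generated-by-prefix T T′ c (gen T p) gen′ (proj₂ (,-injective same))
      where
      gen : ∀ T (p : ¬ L < J T) → Generates F T (resize L (shortestRegister T))
      gen T p = generates-resize T (shortestRegister T) (ℕ.≮⇒≥ p) (shortestRegister-generates T)
      c = resize L (shortestRegister T)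
      gen′ : Generates F T′ c
      gen′ = subst (Generates F T′) (sym (proj₁ (,-injective same))) (gen T′ p′)

module HighComplexity (F : FiniteField) (JLC : ∀ k l → MultiSeq F k l → ℕ)
                      (isJLC : ∀ k l (T : MultiSeq F k l) → IsJointLinearComplexity F T (JLC k l T))
                      (m′ n L : ℕ) where

  open import Data.Nat as ℕ using (ℕ; zero; suc; _≤_; _<_; _∸_; _^_; _<?_)
  import Data.Nat.Properties as ℕ
  open import Data.Nat.Induction using (<-rec)
  open import Data.Fin as Fin using (Fin; zero; suc; toℕ; fromℕ<; combine; remQuot; opposite; punchOut)
  import Data.Fin.Properties as Fin
  open import Data.Fin.Permutation using (reverse)
  open import Data.Vec as Vec using (Vec; lookup; tabulate; removeAt)
  open import Data.Vec.Properties using (lookup∘tabulate; removeAt-punchOut)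
  open import Data.List using (cartesianProduct; length)
  open import Data.List.Membership.Propositional using (_∈_)
  open import Data.List.Membership.Propositional.Properties using (∈-cartesianProduct⁺)
  open import Data.Product using (∃; _×_; _,_; proj₁; proj₂)
  open import Data.Product.Properties using (,-injective)
  open import Data.Sum using (_⊎_; inj₁; inj₂; [_,_]′)
  open import Function using (id; _∘_)
  open import Relation.Nullary using (yes; no; contradiction)
  open import Relation.Binary using (tri<; tri≈; tri>)
  open import Relation.Binary.PropositionalEquality hiding (J)
  open Counting
  open FiniteFieldProperties F
  open Enumeration F
  open LinearAlgebra F
  open LinearRecurrences F
  open Complexity F JLC isJLC


  m k R : ℕ
  m = suc m′
  k = n ∸ L
  R = m ℕ.* k

  block : Fin R → Fin m
  block r = proj₁ (remQuot {m} k r)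

  offset : Fin R → Fin k
  offset r = proj₂ (remQuot {m} k r)

  s : MultiSeq F m n → Fin m → ℕ → Carrier
  s T i = at F (lookup T i)

  -- Equation r = (i, t) says that the term of sequence i at position t + L is
  -- the combination, with coefficients c l, of the terms at positions t + l.
  recurrenceMatrix : MultiSeq F m n → Matrix R L
  recurrenceMatrix T r l = s T (block r) (toℕ (offset r) ℕ.+ toℕ l)

  recurrenceTarget : MultiSeq F m n → Fin R → Carrier
  recurrenceTarget T r = s T (block r) (toℕ (offset r) ℕ.+ L)

  solvable⇒J≤ : ∀ T → Solvable (recurrenceMatrix T) → J T ≤ L
  solvable⇒J≤ T solve = J-minimal T register generates
    where
    c = proj₁ (solve (recurrenceTarget T))

    equation : ∀ i (t : Fin k) → ∑[ l < L ] (s T i (toℕ t ℕ.+ toℕ l) * c l) ≡ s T i (toℕ t ℕ.+ L)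
    equation i t = subst (λ (i , t) → ∑[ l < L ] (s T i (toℕ t ℕ.+ toℕ l) * c l) ≡ s T i (toℕ t ℕ.+ L))
                         (Fin.remQuot-combine i t) (proj₂ (solve (recurrenceTarget T)) (combine i t))

    -- The register lists the solution in reverse: c₁ multiplies the most recent term.
    register : Vec Carrier L
    register = tabulate (λ κ → c (opposite κ))

    generates : Generates F T register
    generates i j L≤j j<n = begin
      s T i j                                                      ≡⟨ cong (s T i) t+L≡j ⟨
      s T i (toℕ t ℕ.+ L)                                          ≡⟨ equation i t ⟨
      ∑[ l < L ] (s T i (toℕ t ℕ.+ toℕ l) * c l)                   ≡⟨ sum-cong-≗ (λ l → *-comm _ (c l)) ⟩
      ∑[ l < L ] (c l * s T i (toℕ t ℕ.+ toℕ l))                   ≡⟨ ∑-permute (λ l → c l * s T i (toℕ t ℕ.+ toℕ l)) reverse ⟩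
      ∑[ κ < L ] (c (opposite κ) * s T i (toℕ t ℕ.+ toℕ (opposite κ)))
        ≡⟨ sum-cong-≗ (λ κ → cong₂ _*_ (lookup∘tabulate _ κ) (cong (s T i) (back κ))) ⟨
      ∑[ κ < L ] (lookup register κ * s T i (j ∸ suc (toℕ κ)))     ≡⟨ sumF≡sum {L} _ ⟨
      sumF F (λ κ → lookup register κ * s T i (j ∸ suc (toℕ κ)))   ∎
      where
      open ≡-Reasoning
      t : Fin k
      t = fromℕ< (ℕ.∸-monoˡ-< j<n L≤j)
      t+L≡j : toℕ t ℕ.+ L ≡ j
      t+L≡j = trans (cong (ℕ._+ L) (Fin.toℕ-fromℕ< _)) (ℕ.m∸n+n≡m L≤j)
      back : ∀ κ → j ∸ suc (toℕ κ) ≡ toℕ t ℕ.+ toℕ (opposite κ)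
      back κ = begin
        j ∸ suc (toℕ κ)                ≡⟨ cong (_∸ suc (toℕ κ)) t+L≡j ⟨
        toℕ t ℕ.+ L ∸ suc (toℕ κ)      ≡⟨ ℕ.+-∸-assoc (toℕ t) (Fin.toℕ<n κ) ⟩
        toℕ t ℕ.+ (L ∸ suc (toℕ κ))    ≡⟨ cong (toℕ t ℕ.+_) (Fin.opposite-prop κ) ⟨
        toℕ t ℕ.+ toℕ (opposite κ)     ∎

  index-≡ : ∀ {r r′} → block r ≡ block r′ → toℕ (offset r) ≡ toℕ (offset r′) → r ≡ r′
  index-≡ {r} {r′} b≡b′ o≡o′ = begin
    r                               ≡⟨ Fin.combine-remQuot {m} k r ⟨
    combine (block r) (offset r)    ≡⟨ cong₂ combine b≡b′ (Fin.toℕ-injective o≡o′) ⟩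
    combine (block r′) (offset r′)  ≡⟨ Fin.combine-remQuot {m} k r′ ⟩
    r′                              ∎
    where open ≡-Reasoning

  index-< : ∀ {r r′} → block r ≡ block r′ → toℕ (offset r) < toℕ (offset r′) → r Fin.< r′
  index-< {r} {r′} b≡b′ o<o′ = subst₂ _<_ (toℕ-index r) (toℕ-index r′)
      (subst (λ b → k ℕ.* toℕ (block r) ℕ.+ toℕ (offset r) < k ℕ.* toℕ b ℕ.+ toℕ (offset r′)) b≡b′
        (ℕ.+-monoʳ-< (k ℕ.* toℕ (block r)) o<o′))
    where
    toℕ-index : ∀ r → k ℕ.* toℕ (block r) ℕ.+ toℕ (offset r) ≡ toℕ r
    toℕ-index r = trans (sym (Fin.toℕ-combine (block r) (offset r))) (cong toℕ (Fin.combine-remQuot {m} k r))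

  -- skip t enumerates the positions outside the window t, …, t + L - 1.
  skip : ℕ → ℕ → ℕ
  skip t u with u <? t
  ... | yes _ = u
  ... | no  _ = u ℕ.+ L

  skip-< : ∀ {t u} → u < t → skip t u ≡ u
  skip-< {t} {u} u<t with u <? t
  ... | yes _   = refl
  ... | no  u≮t = contradiction u<t u≮t

  skip-≥ : ∀ {t u} → t ≤ u → skip t u ≡ u ℕ.+ L
  skip-≥ {t} {u} t≤u with u <? t
  ... | yes u<t = contradiction t≤u (ℕ.<⇒≱ u<t)
  ... | no  _   = refl

  deleteWindow : ℕ → Vec Carrier n → Vec Carrier k
  deleteWindow t row = tabulate (λ u → at F row (skip t (toℕ u)))

  Residue : Set
  Residue = Vec (Vec Carrier n) m′ × Vec Carrier k

  residue : MultiSeq F m n → Fin R → Residue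
  residue T r = removeAt T (block r) , deleteWindow (toℕ (offset r)) (lookup T (block r))

  -- The pivot of v is its last nonzero entry; the junk second branch is never
  -- taken, since only nonzero kernel vectors are encoded.
  code : MultiSeq F m n → Vec Carrier R → Vec Carrier R × Residue
  code T v = v , [ residue T ∘ proj₁ , (λ _ → removeAt T zero , Vec.replicate k 0#) ]′ (lastNonzero⊎zero (lookup v))

  module Decoding {T T′ : MultiSeq F m n} (y : Fin R → Carrier) (r* : Fin R)
                (y*≢0 : y r* ≢ 0#) (after : ∀ r → r* Fin.< r → y r ≡ 0#)
                (yA≡0  : ∀ l → ∑[ r < R ] (y r * recurrenceMatrix T r l) ≡ 0#)
                (yA′≡0 : ∀ l → ∑[ r < R ] (y r * recurrenceMatrix T′ r l) ≡ 0#)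
                (same-residue : residue T r* ≡ residue T′ r*) where

    i = block r*
    t* = toℕ (offset r*)

    other-rows : ∀ {i′} → i ≢ i′ → lookup T i′ ≡ lookup T′ i′
    other-rows {i′} i≢i′ = begin
      lookup T i′                               ≡⟨ removeAt-punchOut T i≢i′ ⟨
      lookup (removeAt T i) (punchOut i≢i′)     ≡⟨ cong (λ U → lookup U (punchOut i≢i′)) (proj₁ (,-injective same-residue)) ⟩
      lookup (removeAt T′ i) (punchOut i≢i′)    ≡⟨ removeAt-punchOut T′ i≢i′ ⟩
      lookup T′ i′                              ∎
      where open ≡-Reasoning

    outside-window : ∀ {u} → u < k → s T i (skip t* u) ≡ s T′ i (skip t* u)
    outside-window {u} u<k = begin
      s T i (skip t* u)                      ≡⟨ at-tabulate (s T i ∘ skip t*) u<k ⟨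
      at F (deleteWindow t* (lookup T i)) u  ≡⟨ cong (λ w → at F w u) (proj₂ (,-injective same-residue)) ⟩
      at F (deleteWindow t* (lookup T′ i)) u ≡⟨ at-tabulate (s T′ i ∘ skip t*) u<k ⟩
      s T′ i (skip t* u)                     ∎
      where open ≡-Reasoning

    -- Equation l of the kernel relation involves position t* + l of row i only
    -- through the pivot; every other term is already known to agree.
    inside-window : ∀ (l : Fin L) → (∀ {q} → q < t* ℕ.+ toℕ l → s T i q ≡ s T′ i q) →
      s T i (t* ℕ.+ toℕ l) ≡ s T′ i (t* ℕ.+ toℕ l)
    inside-window l earlier = *-cancelˡ-≢0 (y r*) y*≢0
      (sum-agree-except _ _ r* agree (trans (yA≡0 l) (sym (yA′≡0 l))))
      where
      agree : ∀ r → r ≢ r* → y r * recurrenceMatrix T r l ≡ y r * recurrenceMatrix T′ r l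
      agree r r≢r* with block r Fin.≟ i | ℕ.<-cmp (toℕ (offset r)) t*
      ... | no b≢i  | _ = cong (λ row → y r * at F row (toℕ (offset r) ℕ.+ toℕ l)) (other-rows (b≢i ∘ sym))
      ... | yes b≡i | tri< o<t _ _ = cong (y r *_)
            (subst (λ i′ → s T i′ q ≡ s T′ i′ q) (sym b≡i) (earlier (ℕ.+-monoˡ-< (toℕ l) o<t)))
        where q = toℕ (offset r) ℕ.+ toℕ l
      ... | yes b≡i | tri≈ _ o≡t _ = contradiction (index-≡ b≡i o≡t) r≢r*
      ... | yes b≡i | tri> _ _ t<o = begin
        y r * recurrenceMatrix T r l   ≡⟨ cong (_* recurrenceMatrix T r l) yr≡0 ⟩
        0# * recurrenceMatrix T r l    ≡⟨ zeroˡ _ ⟩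
        0#                             ≡⟨ zeroˡ _ ⟨
        0# * recurrenceMatrix T′ r l   ≡⟨ cong (_* recurrenceMatrix T′ r l) yr≡0 ⟨
        y r * recurrenceMatrix T′ r l  ∎
        where
        open ≡-Reasoning
        yr≡0 = after r (index-< (sym b≡i) t<o)

    pivot-row : ∀ pos → s T i pos ≡ s T′ i pos
    pivot-row = <-rec _ entry
      where
      entry : ∀ pos → (∀ {q} → q < pos → s T i q ≡ s T′ i q) → s T i pos ≡ s T′ i pos
      entry pos earlier with pos <? t* | pos <? t* ℕ.+ L | pos <? n
      ... | yes pos<t | _ | _ = subst (λ q → s T i q ≡ s T′ i q) (skip-< pos<t)
            (outside-window (ℕ.<-trans pos<t (Fin.toℕ<n (offset r*))))
      ... | no pos≮t | yes pos<t+L | _ = subst (λ q → s T i q ≡ s T′ i q) t+l≡pos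
            (inside-window l (λ q<t+l → earlier (subst (_ <_) t+l≡pos q<t+l)))
        where
        t≤pos = ℕ.≮⇒≥ pos≮t
        l = fromℕ< (ℕ.+-cancelˡ-< t* (pos ∸ t*) L (subst (_< t* ℕ.+ L) (sym (ℕ.m+[n∸m]≡n t≤pos)) pos<t+L))
        t+l≡pos = trans (cong (t* ℕ.+_) (Fin.toℕ-fromℕ< _)) (ℕ.m+[n∸m]≡n t≤pos)
      ... | no _ | no pos≮t+L | yes pos<n = subst (λ q → s T i q ≡ s T′ i q) skip≡pos
            (outside-window (ℕ.∸-monoˡ-< pos<n L≤pos))
        where
        t+L≤pos = ℕ.≮⇒≥ pos≮t+L
        L≤pos = ℕ.≤-trans (ℕ.m≤n+m L t*) t+L≤pos
        skip≡pos = trans (skip-≥ (ℕ.m+n≤o⇒m≤o∸n t* t+L≤pos)) (ℕ.m∸n+n≡m L≤pos)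
      ... | no _ | no _ | no pos≮n = trans (at-≥ (lookup T i) (ℕ.≮⇒≥ pos≮n)) (sym (at-≥ (lookup T′ i) (ℕ.≮⇒≥ pos≮n)))

    T≡T′ : T ≡ T′
    T≡T′ = vec-extensional T T′ row
      where
      row : ∀ i′ → lookup T i′ ≡ lookup T′ i′
      row i′ with i Fin.≟ i′
      ... | yes refl = at-extensional _ _ pivot-row
      ... | no  i≢i′ = other-rows i≢i′

  code-injective : ∀ {T T′} v → (∃ λ r → lookup v r ≢ 0#) →
    (∀ l → ∑[ r < R ] (lookup v r * recurrenceMatrix T r l) ≡ 0#) →
    (∀ l → ∑[ r < R ] (lookup v r * recurrenceMatrix T′ r l) ≡ 0#) →
    code T v ≡ code T′ v → T ≡ T′
  code-injective v (r₁ , v₁≢0) yA≡0 yA′≡0 same with lastNonzero⊎zero (lookup v)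
  ... | inj₁ (r* , v*≢0 , after) = Decoding.T≡T′ (lookup v) r* v*≢0 after yA≡0 yA′≡0 (proj₂ (,-injective same))
  ... | inj₂ v≡0                 = contradiction (v≡0 r₁) v₁≢0

  kernelOf : ∀ T → L < J T → HasLeftKernel (recurrenceMatrix T)
  kernelOf T L<J = [ id , (λ solvable → contradiction (solvable⇒J≤ T solvable) (ℕ.<⇒≱ L<J)) ]′
                     (leftKernel⊎solvable (recurrenceMatrix T))

  encode : ∀ T → L < J T → Vec Carrier R × Residue
  encode T L<J = code T (tabulate (proj₁ (kernelOf T L<J)))

  encode-injective : ∀ {T T′} p p′ → encode T p ≡ encode T′ p′ → T ≡ T′
  encode-injective {T} {T′} p p′ same = code-injective v (r₁ , v₁≢0) vA≡0 vA′≡0 same′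
    where
    y  = proj₁ (kernelOf T p)
    y′ = proj₁ (kernelOf T′ p′)
    v  = tabulate y
    r₁ = proj₁ (proj₁ (proj₂ (kernelOf T p)))
    v≡v′ : v ≡ tabulate y′
    v≡v′ = proj₁ (,-injective same)
    same′ : code T v ≡ code T′ v
    same′ = subst (λ w → code T v ≡ code T′ w) (sym v≡v′) same
    v₁≢0 : lookup v r₁ ≢ 0#
    v₁≢0 = subst (_≢ 0#) (sym (lookup∘tabulate y r₁)) (proj₂ (proj₁ (proj₂ (kernelOf T p))))
    vA≡0 : ∀ l → ∑[ r < R ] (lookup v r * recurrenceMatrix T r l) ≡ 0#
    vA≡0 l = trans (sum-cong-≗ (λ r → cong (_* recurrenceMatrix T r l) (lookup∘tabulate y r)))
                   (proj₂ (proj₂ (kernelOf T p)) l)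
    vA′≡0 : ∀ l → ∑[ r < R ] (lookup v r * recurrenceMatrix T′ r l) ≡ 0#
    vA′≡0 l = trans (sum-cong-≗ (λ r → cong (_* recurrenceMatrix T′ r l)
                                         (trans (cong (λ w → lookup w r) v≡v′) (lookup∘tabulate y′ r))))
                    (proj₂ (proj₂ (kernelOf T′ p′)) l)

  count-J> : count (λ T → L <? J T) (allMultiSeqs F m n) ≤ size ^ R ℕ.* ((size ^ n) ^ m′ ℕ.* size ^ k)
  count-J> = subst (count (λ T → L <? J T) (allMultiSeqs F m n) ≤_) length-targets
    (count≤length-of-injection (λ T → L <? J T) (allMultiSeqs-unique m n) encode (λ _ p → encode∈targets p) encode-injective)
    where
    residues = cartesianProduct (allVecs F (allVecs F elems n) m′) (allVecs F elems k)
    targets  = cartesianProduct (allVecs F elems R) residues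

    length-targets : length targets ≡ size ^ R ℕ.* ((size ^ n) ^ m′ ℕ.* size ^ k)
    length-targets = trans (length-cartesianProductWith _,_ (allVecs F elems R) residues)
      (cong₂ ℕ._*_ (length-allVecs elems R)
        (trans (length-cartesianProductWith _,_ (allVecs F (allVecs F elems n) m′) (allVecs F elems k))
          (cong₂ ℕ._*_ (trans (length-allVecs (allVecs F elems n) m′) (cong (_^ m′) (length-allVecs elems n)))
                       (length-allVecs elems k))))

    encode∈targets : ∀ {T} (p : L < J T) → encode T p ∈ targets
    encode∈targets p = ∈-cartesianProduct⁺ (∈-allVecs elems complete _)
      (∈-cartesianProduct⁺ (∈-allVecs (allVecs F elems n) (∈-allVecs elems complete) _) (∈-allVecs elems complete _))

module Estimate (q : ℕ) (2≤q : 2 ≤ q) (m n : ℕ) (c d : ℕ → ℕ) where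

  open import Data.Nat as ℕ using (ℕ; suc; _+_; _*_; _^_; _≤_; _<_; _∸_; _/_; _%_; _≤?_; z≤n; s≤s; NonZero)
  open import Data.Nat.Properties
  open import Data.Nat.DivMod using (m≡m%n+[m/n]*n; m%n<n)
  open import Data.Nat.Solver using (module +-*-Solver)
  open import Relation.Nullary using (yes; no)
  open import Relation.Binary.PropositionalEquality
  open NatSums

  open +-*-Solver

  K N : ℕ
  K = suc m
  N = q ^ (m * n)

  instance
    q-nonZero : NonZero q
    q-nonZero = ℕ.>-nonZero (≤-trans (s≤s z≤n) 2≤q)

  N-nonZero : NonZero N
  N-nonZero = m^n≢0 q (m * n)

  -- b = ⌊mn / K⌋ is the expected complexity up to O(1): below b almost every
  -- multisequence has complexity above L, above b + 1 almost none.
  b : ℕ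
  b = (m * n) / K

  K*b≤mn : K * b ≤ m * n
  K*b≤mn = subst (K * b ≤_) (sym (trans (m≡m%n+[m/n]*n (m * n) K) (cong ((m * n) % K +_) (*-comm b K))))
                 (m≤n+m (K * b) ((m * n) % K))

  mn<K*[1+b] : m * n < K * suc b
  mn<K*[1+b] = begin-strict
    m * n                ≡⟨ m≡m%n+[m/n]*n (m * n) K ⟩
    (m * n) % K + b * K  <⟨ +-monoˡ-< (b * K) (m%n<n (m * n) K) ⟩
    K + b * K            ≡⟨ cong (K +_) (*-comm b K) ⟩
    K + K * b            ≡⟨ *-suc K b ⟨
    K * suc b            ∎
    where open ≤-Reasoning

  b≤n : b ≤ n
  b≤n = *-cancelˡ-≤ K (≤-trans K*b≤mn (*-monoˡ-≤ n (n≤1+n m)))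

  module _ (c+d≡N : ∀ L → c L + d L ≡ N) where

    c≤N : ∀ L → c L ≤ N
    c≤N L = subst (c L ≤_) (c+d≡N L) (m≤m+n (c L) (d L))

    module _ (d≤ : ∀ L → d L ≤ q ^ (K * L)) where

      b*N≤S+N : b * N ≤ sumBelow n c + N
      b*N≤S+N = begin
        b * N                                   ≡⟨ sumBelow-const b N ⟨
        sumBelow b (λ _ → N)                    ≡⟨ sumBelow-cong b (λ L → sym (c+d≡N L)) ⟩
        sumBelow b (λ L → c L + d L)            ≡⟨ sumBelow-distrib-+ b ⟩
        sumBelow b c + sumBelow b d             ≤⟨ +-mono-≤ (sumBelow-monoˡ-≤ c b≤n) (sumBelow-mono-≤ b d≤Qᴸ) ⟩
        sumBelow n c + sumBelow b ((q ^ K) ^_)  ≤⟨ +-monoʳ-≤ (sumBelow n c) (sumBelow-geometric 2≤q^K b) ⟩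
        sumBelow n c + (q ^ K) ^ b              ≡⟨ cong (sumBelow n c +_) (^-*-assoc q K b) ⟩
        sumBelow n c + q ^ (K * b)              ≤⟨ +-monoʳ-≤ (sumBelow n c) (^-monoʳ-≤ q K*b≤mn) ⟩
        sumBelow n c + N                        ∎
        where
        open ≤-Reasoning
        d≤Qᴸ : ∀ L → d L ≤ (q ^ K) ^ L
        d≤Qᴸ L = subst (d L ≤_) (sym (^-*-assoc q K L)) (d≤ L)
        2≤q^K : 2 ≤ q ^ K
        2≤q^K = ≤-trans 2≤q (m≤m*n q (q ^ m) {{m^n≢0 q m}})

      lower : m * n * N ≤ K * sumBelow n c + 2 * K * N
      lower = begin
        m * n * N                     ≤⟨ *-monoˡ-≤ N (<⇒≤ mn<K*[1+b]) ⟩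
        K * suc b * N                 ≡⟨ *-assoc K (suc b) N ⟩
        K * (N + b * N)               ≤⟨ *-monoʳ-≤ K (+-monoʳ-≤ N b*N≤S+N) ⟩
        K * (N + (sumBelow n c + N))  ≡⟨ solve 3 (λ K N S → K :* (N :+ (S :+ N)) := K :* S :+ con 2 :* K :* N)
                                                 refl K N (sumBelow n c) ⟩
        K * sumBelow n c + 2 * K * N  ∎
        where open ≤-Reasoning

    module _ (c*qᴷᴸ≤N² : ∀ L → L ≤ n → c L * q ^ (K * L) ≤ N * N) where

      a : ℕ
      a = suc b

      tail-term : ∀ t → a + t ≤ n → c (a + t) * 2 ^ t ≤ N
      tail-term t a+t≤n = *-cancelʳ-≤ (c (a + t) * 2 ^ t) N N {{N-nonZero}} (begin
        c (a + t) * 2 ^ t * N          ≡⟨ *-assoc (c (a + t)) (2 ^ t) N ⟩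
        c (a + t) * (2 ^ t * N)        ≤⟨ *-monoʳ-≤ (c (a + t)) 2ᵗN≤q^K[a+t] ⟩
        c (a + t) * q ^ (K * (a + t))  ≤⟨ c*qᴷᴸ≤N² (a + t) a+t≤n ⟩
        N * N                          ∎)
        where
        open ≤-Reasoning
        2ᵗN≤q^K[a+t] : 2 ^ t * N ≤ q ^ (K * (a + t))
        2ᵗN≤q^K[a+t] = begin
          2 ^ t * N                  ≤⟨ *-mono-≤ (≤-trans (^-monoˡ-≤ t 2≤q) (^-monoʳ-≤ q (m≤n*m t K)))
                                                 (^-monoʳ-≤ q (<⇒≤ mn<K*[1+b])) ⟩
          q ^ (K * t) * q ^ (K * a)  ≡⟨ ^-distribˡ-+-* q (K * t) (K * a) ⟨
          q ^ (K * t + K * a)        ≡⟨ cong (q ^_) (trans (+-comm (K * t) (K * a)) (sym (*-distribˡ-+ K a t))) ⟩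
          q ^ (K * (a + t))          ∎

      S≤[b+3]N : sumBelow n c ≤ (b + 3) * N
      S≤[b+3]N with n ≤? a
      ... | yes n≤a = begin
        sumBelow n c          ≤⟨ sumBelow-mono-≤ n c≤N ⟩
        sumBelow n (λ _ → N)  ≡⟨ sumBelow-const n N ⟩
        n * N                 ≤⟨ *-monoˡ-≤ N (≤-trans n≤a (≤-trans (s≤s (m≤m+n b 2)) (≤-reflexive (sym (+-suc b 2))))) ⟩
        (b + 3) * N           ∎
        where open ≤-Reasoning
      ... | no n≰a = begin
        sumBelow n c                                        ≡⟨ cong (λ z → sumBelow z c) a+[n∸a]≡n ⟨
        sumBelow (a + (n ∸ a)) c                            ≡⟨ sumBelow-+ c a (n ∸ a) ⟩
        sumBelow a c + sumBelow (n ∸ a) (λ t → c (a + t))   ≤⟨ +-mono-≤ (sumBelow-mono-≤ a c≤N) tail ⟩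
        sumBelow a (λ _ → N) + 2 * N                        ≡⟨ cong (_+ 2 * N) (sumBelow-const a N) ⟩
        a * N + 2 * N                                       ≡⟨ *-distribʳ-+ N a 2 ⟨
        (a + 2) * N                                         ≡⟨ cong (_* N) (+-suc b 2) ⟨
        (b + 3) * N                                         ∎
        where
        open ≤-Reasoning
        a+[n∸a]≡n = m+[n∸m]≡n (<⇒≤ (≰⇒> n≰a))
        tail = sumBelow-halving (λ t → c (a + t)) (n ∸ a) (λ t t<n∸a →
          tail-term t (<⇒≤ (subst (a + t <_) a+[n∸a]≡n (+-monoʳ-< a t<n∸a))))

      upper : K * sumBelow n c ≤ m * n * N + 3 * K * N
      upper = begin
        K * sumBelow n c       ≤⟨ *-monoʳ-≤ K S≤[b+3]N ⟩
        K * ((b + 3) * N)      ≡⟨ solve 3 (λ K b N → K :* ((b :+ con 3) :* N) := K :* b :* N :+ con 3 :* K :* N) refl K b N ⟩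
        K * b * N + 3 * K * N  ≤⟨ +-monoˡ-≤ (3 * K * N) (*-monoˡ-≤ N K*b≤mn) ⟩
        m * n * N + 3 * K * N  ∎
        where open ≤-Reasoning

module RationalDistance where

  open import Data.Nat as ℕ using (ℕ; suc; _+_; _*_; _≤_; _≤?_; NonZero)
  import Data.Nat.Properties as ℕ
  open import Data.Integer as ℤ using (+_; _⊖_)
  import Data.Integer.Properties as ℤ
  open import Data.Rational as ℚ using (_/_; ∣_∣; _-_; toℚᵘ)
  import Data.Rational.Properties as ℚ
  open import Data.Rational.Unnormalised as ℚᵘ using (mkℚᵘ; *≤*)
  import Data.Rational.Unnormalised.Properties as ℚᵘ
  open import Relation.Nullary using (yes; no)
  open import Relation.Binary.PropositionalEquality

  ∣⊖∣≤ : ∀ {x y e} → x ≤ y + e → y ≤ x + e → ℤ.∣ x ⊖ y ∣ ≤ e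
  ∣⊖∣≤ {x} {y} x≤y+e y≤x+e with x ≤? y
  ... | yes x≤y = subst (_≤ _) (sym (ℤ.∣⊖∣-≤ x≤y)) (ℕ.m≤n+o⇒m∸n≤o y x y≤x+e)
  ... | no  x≰y = subst (_≤ _) (sym (trans (ℤ.∣m⊖n∣≡∣n⊖m∣ x y) (ℤ.∣⊖∣-< (ℕ.≰⇒> x≰y))))
                       (ℕ.m≤n+o⇒m∸n≤o x y x≤y+e)

  -- Compared through unnormalised representatives, where the difference is
  -- (S K - A N) / (N K).
  ∣/-/∣≤ : ∀ S A N K C .{{_ : NonZero N}} .{{_ : NonZero K}} →
    ℤ.∣ S * K ⊖ A * N ∣ ≤ C * (N * K) → ∣ + S / N - + A / K ∣ ℚ.≤ + C / 1
  ∣/-/∣≤ S A N@(suc N-1) K@(suc K-1) C bound = ℚ.toℚᵘ-cancel-≤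
      (ℚᵘ.≤-respˡ-≃ (ℚᵘ.≃-sym unnormalised) (ℚᵘ.≤-respʳ-≃ (ℚᵘ.≃-sym (ℚ.toℚᵘ-fromℚᵘ (mkℚᵘ (+ C) 0))) core))
    where
    x = + S / N
    y = + A / K
    xᵘ = mkℚᵘ (+ S) N-1
    yᵘ = mkℚᵘ (+ A) K-1

    unnormalised : toℚᵘ ∣ x - y ∣ ℚᵘ.≃ ℚᵘ.∣ xᵘ ℚᵘ.- yᵘ ∣
    unnormalised = ℚᵘ.≃-trans (ℚ.toℚᵘ-homo-∣-∣ (x - y)) (ℚᵘ.∣-∣-cong (ℚᵘ.≃-trans (ℚ.toℚᵘ-homo-+ x (ℚ.- y))
      (ℚᵘ.+-cong (ℚ.toℚᵘ-fromℚᵘ xᵘ) (ℚᵘ.≃-trans (ℚ.toℚᵘ-homo‿- y) (ℚᵘ.-‿cong (ℚ.toℚᵘ-fromℚᵘ yᵘ))))))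

    numerator : ℤ.∣ + S ℤ.* + K ℤ.+ (ℤ.- + A) ℤ.* + N ∣ ≡ ℤ.∣ S * K ⊖ A * N ∣
    numerator = cong ℤ.∣_∣ (begin
      + S ℤ.* + K ℤ.+ (ℤ.- + A) ℤ.* + N   ≡⟨ cong₂ ℤ._+_ (ℤ.pos-* S K) (ℤ.neg-distribˡ-* (+ A) (+ N)) ⟨
      + (S * K) ℤ.+ ℤ.- (+ A ℤ.* + N)     ≡⟨ cong (λ z → + (S * K) ℤ.- z) (ℤ.pos-* A N) ⟨
      + (S * K) ℤ.- + (A * N)             ≡⟨ ℤ.m-n≡m⊖n (S * K) (A * N) ⟩
      S * K ⊖ A * N                       ∎)
      where open ≡-Reasoning

    core : ℚᵘ.∣ xᵘ ℚᵘ.- yᵘ ∣ ℚᵘ.≤ mkℚᵘ (+ C) 0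
    core = *≤* (subst₂ ℤ._≤_ (ℤ.pos-* distance 1) (ℤ.pos-* C (N * K))
      (ℤ.+≤+ (subst (_≤ C * (N * K)) (trans (sym numerator) (sym (ℕ.*-identityʳ distance))) bound)))
      where distance = ℤ.∣ + S ℤ.* + K ℤ.+ (ℤ.- + A) ℤ.* + N ∣

open import Data.Nat using (ℕ; suc; _+_; _*_; _^_; _≤_; _∸_; _<?_; s≤s; z≤n)
open import Data.Nat.Properties
open import Data.Nat.Solver using (module +-*-Solver)
open import Data.Nat.ListAction using (sum)
open import Data.List using (map)
open import Data.Product using (_,_)
import Data.Integer as ℤ
open import Relation.Nullary.Decidable using (¬?)
open import Relation.Binary.PropositionalEquality hiding (J)
open Counting
open NatSums
open RationalDistance

module _ (q : ℕ) where
  open +-*-Solver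

  ^-+-* : ∀ a b → q ^ a * q ^ b ≡ q ^ (a + b)
  ^-+-* a b = sym (^-distribˡ-+-* q a b)

  low-exponent : ∀ m L → q ^ L * (q ^ L) ^ m ≡ q ^ (suc m * L)
  low-exponent m L = trans (cong (q ^ L *_) (^-*-assoc q L m))
    (trans (^-+-* L (L * m)) (cong (q ^_) (solve 2 (λ m L → L :+ L :* m := (con 1 :+ m) :* L) refl m L)))

  high-exponent : ∀ m′ n L → L ≤ n →
    q ^ (suc m′ * (n ∸ L)) * ((q ^ n) ^ m′ * q ^ (n ∸ L)) * q ^ (suc (suc m′) * L) ≡ q ^ (suc m′ * n) * q ^ (suc m′ * n)
  high-exponent m′ n L L≤n = begin
    q ^ (m * e) * ((q ^ n) ^ m′ * q ^ e) * q ^ (suc m * L)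
      ≡⟨ cong (λ z → q ^ (m * e) * (z * q ^ e) * q ^ (suc m * L)) (^-*-assoc q n m′) ⟩
    q ^ (m * e) * (q ^ (n * m′) * q ^ e) * q ^ (suc m * L)
      ≡⟨ cong (λ z → q ^ (m * e) * z * q ^ (suc m * L)) (^-+-* (n * m′) e) ⟩
    q ^ (m * e) * q ^ (n * m′ + e) * q ^ (suc m * L)
      ≡⟨ trans (cong (_* q ^ (suc m * L)) (^-+-* (m * e) (n * m′ + e))) (^-+-* (m * e + (n * m′ + e)) (suc m * L)) ⟩
    q ^ (m * e + (n * m′ + e) + suc m * L)
      ≡⟨ cong (q ^_) exponent ⟩
    q ^ (m * n + m * n)
      ≡⟨ ^-+-* (m * n) (m * n) ⟨
    q ^ (m * n) * q ^ (m * n) ∎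
    where
    open ≡-Reasoning
    m = suc m′
    e = n ∸ L
    exponent : m * e + (n * m′ + e) + suc m * L ≡ m * n + m * n
    exponent = begin
      m * e + (n * m′ + e) + suc m * L              ≡⟨ cong (λ z → m * e + (z * m′ + e) + suc m * L) L+e≡n ⟨
      m * e + ((L + e) * m′ + e) + suc m * L        ≡⟨ solve 3 (λ m′ L e → (con 1 :+ m′) :* e :+ ((L :+ e) :* m′ :+ e) :+ (con 2 :+ m′) :* L
                                                          := (con 1 :+ m′) :* (L :+ e) :+ (con 1 :+ m′) :* (L :+ e)) refl m′ L e ⟩
      m * (L + e) + m * (L + e)                     ≡⟨ cong (λ z → m * z + m * z) L+e≡n ⟩
      m * n + m * n                                 ∎
      where L+e≡n = m+[n∸m]≡n L≤n

distance-bound : ∀ S A N K → K * S ≤ A + 3 * K * N → A ≤ K * S + 2 * K * N → ℤ.∣ S * K ℤ.⊖ A ∣ ≤ 3 * (N * K)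
distance-bound S A N K upper lower = ∣⊖∣≤
  (subst₂ _≤_ (*-comm K S) (cong (λ e → A + e) 3KN≡3NK) upper)
  (≤-trans lower (subst₂ (λ x e → K * S + 2 * K * N ≤ x + e) (*-comm K S) 3KN≡3NK
    (+-monoʳ-≤ (K * S) (*-monoˡ-≤ N (*-monoˡ-≤ K (s≤s (s≤s (z≤n {1}))))))))
  where
  3KN≡3NK : 3 * K * N ≡ 3 * (N * K)
  3KN≡3NK = trans (*-assoc 3 K N) (cong (3 *_) (*-comm K N))

module Layers (F : FiniteField) (JLC : ∀ k l → MultiSeq F k l → ℕ)
              (isJLC : ∀ k l (T : MultiSeq F k l) → IsJointLinearComplexity F T (JLC k l T))
              (m′ n : ℕ) where

  open FiniteFieldProperties F using (size; 2≤size)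
  open Enumeration F using (length-allMultiSeqs)
  open Complexity F JLC isJLC

  m N S : ℕ
  m = suc m′
  N = size ^ (m * n)
  S = sum (map (JLC m n) (allMultiSeqs F m n))

  above atMost : ℕ → ℕ
  above  L = count (λ T → L <? J T) (allMultiSeqs F m n)
  atMost L = count (λ T → ¬? (L <? J T)) (allMultiSeqs F m n)

  S≡sumBelow-above : S ≡ sumBelow n above
  S≡sumBelow-above = sum≡sumBelow-count-< (JLC m n) n J≤n (allMultiSeqs F m n)

  above+atMost≡N : ∀ L → above L + atMost L ≡ N
  above+atMost≡N L = trans (count+count-¬≡length (λ T → L <? J T) (allMultiSeqs F m n))
    (trans (length-allMultiSeqs m n) (trans (^-*-assoc size n m) (cong (size ^_) (*-comm n m))))

  atMost≤ : ∀ L → atMost L ≤ size ^ (suc m * L)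
  atMost≤ L = subst (atMost L ≤_) (low-exponent size m L) (count-J≤ m n L)

  above≤ : ∀ L → L ≤ n → above L * size ^ (suc m * L) ≤ N * N
  above≤ L L≤n = subst (above L * size ^ (suc m * L) ≤_) (high-exponent size m′ n L L≤n)
    (*-monoˡ-≤ (size ^ (suc m * L)) (HighComplexity.count-J> F JLC isJLC m′ n L))

  distance : ℤ.∣ S * suc m ℤ.⊖ m * n * N ∣ ≤ 3 * (N * suc m)
  distance = subst (λ Σ → ℤ.∣ Σ * suc m ℤ.⊖ m * n * N ∣ ≤ 3 * (N * suc m)) (sym S≡sumBelow-above)
    (distance-bound (sumBelow n above) (m * n * N) N (suc m) (upper above+atMost≡N above≤) (lower above+atMost≡N atMost≤))
    where open Estimate size 2≤size m n above atMost using (upper; lower)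

open import Data.Product using (∃)
open import Data.Integer using (+_)
open import Data.Rational using (ℚ; _/_; ∣_∣; _-_)
open import Data.Rational using () renaming (_≤_ to _≤ℚ_)

theorem1 : (F : FiniteField) (m : ℕ) → 1 ≤ m →
    (JLC : ∀ k l → MultiSeq F k l → ℕ) →
    (∀ k l (T : MultiSeq F k l) → IsJointLinearComplexity F T (JLC k l T)) →
    ∃ λ (C : ℚ) → ∀ (n : ℕ) → 1 ≤ n →
      ∣ expectedJLC F JLC m n - (+ (m * n) / (suc m)) ∣ ≤ℚ C
theorem1 F m@(suc m′) _ JLC isJLC = + 3 / 1 , λ n _ →
  ∣/-/∣≤ (S n) (m * n) (N n) (suc m) 3 {{m^n≢0 (size F) (m * n) {{size-nonZero F}}}} (distance n)
  where
  open FiniteField using (size; size-nonZero)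
  open Layers F JLC isJLC m′ using (S; N; distance)
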